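{- Let $n\ge1$ and $k,r\ge0$ with $k+r\le n-1$. The number of properly-marked $\{L,R\}$-words of length $n-1$ with exactly $k$ marked $L$-elements and $r$ unmarked $L$-elements equals $\binom{n-k-1}{r}\binom{r+k}{r}$.
   Context: A properly-marked $\{L,R\}$-word is a word over the alphabet $\{L^u,L^m,R\}$ in which every occurrence of $L^m$ is either the last letter or is immediately followed by $L^u$ or $L^m$; occurrences of $L^m$ are the marked $L$-elements and occurrences of $L^u$ the unmarked $L$-elements. -}

module Defs where

open import Data.Nat using (ℕ; zero; suc)
open import Data.List using (List; []; _∷_; length; filter; concatMap; map)
open import Data.Product using (_×_; _,_)
open import Data.Unit using (⊤)
open import Data.Empty using (⊥)
open import Relation.Nullary using (Dec; yes; no)
open import Relation.Nullary.Decidable using (_×-dec_)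
open import Relation.Binary.PropositionalEquality using (_≡_)
open import Data.Nat using (_≟_)

data Letter : Set where
  Lu Lm R : Letter

-- Properly marked: every occurrence of Lm is the last letter or is
-- immediately followed by Lu or Lm (i.e. never followed by R).
ProperlyMarked : List Letter → Set
ProperlyMarked [] = ⊤
ProperlyMarked (Lm ∷ R ∷ w) = ⊥
ProperlyMarked (_ ∷ w) = ProperlyMarked w

properlyMarked? : (w : List Letter) → Dec (ProperlyMarked w)
properlyMarked? [] = yes _
properlyMarked? (Lm ∷ R ∷ w) = no (λ ())
properlyMarked? (Lu ∷ w) = properlyMarked? w
properlyMarked? (R ∷ w) = properlyMarked? w
properlyMarked? (Lm ∷ []) = properlyMarked? []
properlyMarked? (Lm ∷ Lu ∷ w) = properlyMarked? (Lu ∷ w)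
properlyMarked? (Lm ∷ Lm ∷ w) = properlyMarked? (Lm ∷ w)

countLm : List Letter → ℕ
countLm [] = 0
countLm (Lm ∷ w) = suc (countLm w)
countLm (_ ∷ w) = countLm w

countLu : List Letter → ℕ
countLu [] = 0
countLu (Lu ∷ w) = suc (countLu w)
countLu (_ ∷ w) = countLu w

words : ℕ → List (List Letter)
words zero = [] ∷ []
words (suc m) = concatMap (λ w → (Lu ∷ w) ∷ (Lm ∷ w) ∷ (R ∷ w) ∷ []) (words m)

Counted : ℕ → ℕ → List Letter → Set
Counted k r w = ProperlyMarked w × (countLm w ≡ k × countLu w ≡ r)

counted? : (k r : ℕ) → (w : List Letter) → Dec (Counted k r w)
counted? k r w = properlyMarked? w ×-dec ((countLm w ≟ k) ×-dec (countLu w ≟ r))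

numWords : ℕ → ℕ → ℕ → ℕ
numWords m k r = length (filter (counted? k r) (words m))

-- A properly-marked word with k marked letters, r unmarked letters and a letters R is
-- an arrangement of its r unmarked letters and a letters R, together with a distribution
-- of the k marked letters into runs placed before an unmarked letter or at the end; so
-- there are C(r + a, r) · C(r + k, r) of them.  We verify this count by induction on the
-- length, classifying words by their first letter: a marked letter must be followed by a
-- word not beginning with R, so the numbers of all words and of words not beginning
-- with R satisfy joint recurrences, which Pascal's rule solves.

module Submission where

open import Defs
open import Data.Nat using (ℕ; _+_; _∸_; _≤_; _*_)
open import Data.Nat.Combinatorics using (_C_)
open import Relation.Binary.PropositionalEquality using (_≡_)

open import Data.Bool using (true; false; if_then_else_)
open import Data.List using (List; []; _∷_; length; filter; concatMap)
open import Data.List.Properties using (filter-none)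
open import Data.List.Relation.Unary.All as All using (All; []; _∷_)
open import Data.List.Relation.Unary.All.Properties using (concat⁺; map⁺)
open import Data.Nat using (zero; suc; _<_; z≤n; s≤s)
open import Data.Nat.Combinatorics using (nCn≡1; nCk+nC[k+1]≡[n+1]C[k+1])
open import Data.Nat.Properties
open import Data.Nat.Tactic.RingSolver using (solve-∀)
open import Data.Product using (_,_)
open import Function using (_∘_)
open import Level using (Level)
open import Relation.Nullary using (does; ¬_)
open import Relation.Unary using (Pred; Decidable)
open import Relation.Binary.PropositionalEquality
  using (refl; sym; trans; cong; cong₂; subst; module ≡-Reasoning)
open ≡-Reasoning

module _ {a p : Level} {A : Set a} where

  length-filter-∷ : {P : Pred A p} (P? : Decidable P) (x : A) (xs : List A) →
    length (filter P? (x ∷ xs)) ≡ (if does (P? x) then 1 else 0) + length (filter P? xs)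
  length-filter-∷ P? x xs with does (P? x)
  ... | true  = refl
  ... | false = refl

  length-filter-cong : {P Q : Pred A p} (P? : Decidable P) (Q? : Decidable Q) →
    (∀ x → does (P? x) ≡ does (Q? x)) → ∀ xs → length (filter P? xs) ≡ length (filter Q? xs)
  length-filter-cong P? Q? P≡Q [] = refl
  length-filter-cong P? Q? P≡Q (x ∷ xs) = begin
    length (filter P? (x ∷ xs))
      ≡⟨ length-filter-∷ P? x xs ⟩
    (if does (P? x) then 1 else 0) + length (filter P? xs)
      ≡⟨ cong₂ (λ b n → (if b then 1 else 0) + n) (P≡Q x) (length-filter-cong P? Q? P≡Q xs) ⟩
    (if does (Q? x) then 1 else 0) + length (filter Q? xs)
      ≡⟨ length-filter-∷ Q? x xs ⟨
    length (filter Q? (x ∷ xs)) ∎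

  length-filter-none : {P : Pred A p} (P? : Decidable P) → (∀ x → ¬ P x) →
    ∀ xs → length (filter P? xs) ≡ 0
  length-filter-none P? ¬P xs = cong length (filter-none P? (All.universal ¬P xs))

length-filter-words-suc : {p : Level} {P : Pred (List Letter) p} (P? : Decidable P) (m : ℕ) →
  length (filter P? (words (suc m))) ≡
    length (filter (P? ∘ (Lu ∷_)) (words m)) + length (filter (P? ∘ (Lm ∷_)) (words m))
      + length (filter (P? ∘ (R ∷_)) (words m))
length-filter-words-suc P? m = split (words m)
  where
  count : (List Letter → List Letter) → List (List Letter) → ℕ
  count f ws = length (filter (P? ∘ f) ws)

  χ : List Letter → ℕ
  χ w = if does (P? w) then 1 else 0

  +-interchange₃ : ∀ x y z u v w → x + (y + (z + (u + v + w))) ≡ x + u + (y + v) + (z + w)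
  +-interchange₃ = solve-∀

  split : ∀ ws → length (filter P? (concatMap (λ w → (Lu ∷ w) ∷ (Lm ∷ w) ∷ (R ∷ w) ∷ []) ws)) ≡
    count (Lu ∷_) ws + count (Lm ∷_) ws + count (R ∷_) ws
  split [] = refl
  split (w ∷ ws) = begin
    length (filter P? ((Lu ∷ w) ∷ (Lm ∷ w) ∷ (R ∷ w) ∷ rest))
      ≡⟨ length-filter-∷ P? _ _ ⟩
    χ (Lu ∷ w) + length (filter P? ((Lm ∷ w) ∷ (R ∷ w) ∷ rest))
      ≡⟨ cong (χ (Lu ∷ w) +_) (length-filter-∷ P? _ _) ⟩
    χ (Lu ∷ w) + (χ (Lm ∷ w) + length (filter P? ((R ∷ w) ∷ rest)))
      ≡⟨ cong (λ n → χ (Lu ∷ w) + (χ (Lm ∷ w) + n)) (length-filter-∷ P? _ _) ⟩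
    χ (Lu ∷ w) + (χ (Lm ∷ w) + (χ (R ∷ w) + length (filter P? rest)))
      ≡⟨ cong (λ n → χ (Lu ∷ w) + (χ (Lm ∷ w) + (χ (R ∷ w) + n))) (split ws) ⟩
    χ (Lu ∷ w) + (χ (Lm ∷ w) + (χ (R ∷ w) + (count (Lu ∷_) ws + count (Lm ∷_) ws + count (R ∷_) ws)))
      ≡⟨ +-interchange₃ (χ (Lu ∷ w)) (χ (Lm ∷ w)) (χ (R ∷ w)) (count (Lu ∷_) ws) (count (Lm ∷_) ws) (count (R ∷_) ws) ⟩
    (χ (Lu ∷ w) + count (Lu ∷_) ws) + (χ (Lm ∷ w) + count (Lm ∷_) ws) + (χ (R ∷ w) + count (R ∷_) ws)
      ≡⟨ cong₂ _+_ (cong₂ _+_ (sym (length-filter-∷ (P? ∘ (Lu ∷_)) w ws))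
                              (sym (length-filter-∷ (P? ∘ (Lm ∷_)) w ws)))
                   (sym (length-filter-∷ (P? ∘ (R ∷_)) w ws)) ⟩
    count (Lu ∷_) (w ∷ ws) + count (Lm ∷_) (w ∷ ws) + count (R ∷_) (w ∷ ws) ∎
    where rest = concatMap (λ w → (Lu ∷ w) ∷ (Lm ∷ w) ∷ (R ∷ w) ∷ []) ws

length-words : ∀ m → All (λ w → length w ≡ m) (words m)
length-words zero    = refl ∷ []
length-words (suc m) =
  concat⁺ (map⁺ (All.map (λ eq → cong suc eq ∷ cong suc eq ∷ cong suc eq ∷ []) (length-words m)))

countLm+countLu≤length : ∀ w → countLm w + countLu w ≤ length w
countLm+countLu≤length []       = z≤n
countLm+countLu≤length (Lu ∷ w) =
  subst (_≤ suc (length w)) (sym (+-suc (countLm w) (countLu w))) (s≤s (countLm+countLu≤length w))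
countLm+countLu≤length (Lm ∷ w) = s≤s (countLm+countLu≤length w)
countLm+countLu≤length (R ∷ w)  = m≤n⇒m≤1+n (countLm+countLu≤length w)

numWords≡0 : ∀ m k r → m < k + r → numWords m k r ≡ 0
numWords≡0 m k r m<k+r =
  cong length (filter-none (counted? k r) (All.map (λ {w} → uncounted w) (length-words m)))
  where
  uncounted : ∀ w → length w ≡ m → ¬ Counted k r w
  uncounted w refl (_ , refl , refl) = <⇒≱ m<k+r (countLm+countLu≤length w)

numWordsStartingWith : Letter → ℕ → ℕ → ℕ → ℕ
numWordsStartingWith x m k r = length (filter (counted? k r ∘ (x ∷_)) (words m))

-- Lm ∷ w is properly marked iff w is properly marked and does not begin with R.
numWordsNotStartingWithR : ℕ → ℕ → ℕ → ℕ
numWordsNotStartingWithR m k r = numWordsStartingWith Lm m (suc k) r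

numWordsStartingWithLu-zero : ∀ m k → numWordsStartingWith Lu m k 0 ≡ 0
numWordsStartingWithLu-zero m k = length-filter-none _ (λ { w (_ , _ , ()) }) (words m)

numWordsStartingWithLu-suc : ∀ m k r → numWordsStartingWith Lu m k (suc r) ≡ numWords m k r
numWordsStartingWithLu-suc m k r = length-filter-cong _ _ (λ _ → refl) (words m)

numWordsStartingWithLm-zero : ∀ m r → numWordsStartingWith Lm m 0 r ≡ 0
numWordsStartingWithLm-zero m r = length-filter-none _ (λ { w (_ , () , _) }) (words m)

numWordsNotStartingWithR-suc : ∀ m k r →
  numWordsNotStartingWithR (suc m) k r ≡ numWordsStartingWith Lu m k r + numWordsStartingWith Lm m k r
numWordsNotStartingWithR-suc m k r = begin
  numWordsNotStartingWithR (suc m) k r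
    ≡⟨ length-filter-words-suc (counted? (suc k) r ∘ (Lm ∷_)) m ⟩
  afterLm Lu + afterLm Lm + afterLm R
    ≡⟨ cong₂ _+_ (cong₂ _+_ (length-filter-cong _ _ (λ _ → refl) (words m))
                            (length-filter-cong _ _ (λ _ → refl) (words m)))
                 (length-filter-none _ (λ { w (() , _) }) (words m)) ⟩
  numWordsStartingWith Lu m k r + numWordsStartingWith Lm m k r + 0
    ≡⟨ +-identityʳ _ ⟩
  numWordsStartingWith Lu m k r + numWordsStartingWith Lm m k r ∎
  where
  afterLm : Letter → ℕ
  afterLm x = length (filter (counted? (suc k) r ∘ (Lm ∷_) ∘ (x ∷_)) (words m))

numWords-suc : ∀ m k r → numWords (suc m) k r ≡ numWordsNotStartingWithR (suc m) k r + numWords m k r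
numWords-suc m k r = begin
  numWords (suc m) k r
    ≡⟨ length-filter-words-suc (counted? k r) m ⟩
  numWordsStartingWith Lu m k r + numWordsStartingWith Lm m k r + numWords m k r
    ≡⟨ cong (_+ numWords m k r) (numWordsNotStartingWithR-suc m k r) ⟨
  numWordsNotStartingWithR (suc m) k r + numWords m k r ∎

-- The number of words with x letters L and y letters R, and of those among them not beginning with R.
arrangements : ℕ → ℕ → ℕ
arrangements zero    y       = 1
arrangements (suc x) zero    = 1
arrangements (suc x) (suc y) = arrangements x (suc y) + arrangements (suc x) y

arrangementsNotStartingWithR : ℕ → ℕ → ℕ
arrangementsNotStartingWithR zero    zero    = 1
arrangementsNotStartingWithR zero    (suc y) = 0
arrangementsNotStartingWithR (suc x) y       = arrangements x y

arrangements-zeroʳ : ∀ x → arrangements x 0 ≡ 1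
arrangements-zeroʳ zero    = refl
arrangements-zeroʳ (suc x) = refl

arrangementsNotStartingWithR-zeroʳ : ∀ x → arrangementsNotStartingWithR x 0 ≡ arrangements x 0
arrangementsNotStartingWithR-zeroʳ zero    = refl
arrangementsNotStartingWithR-zeroʳ (suc x) = arrangements-zeroʳ x

arrangementsNotStartingWithR-suc : ∀ x y →
  arrangementsNotStartingWithR x (suc y) + arrangements x y ≡ arrangements x (suc y)
arrangementsNotStartingWithR-suc zero    y = refl
arrangementsNotStartingWithR-suc (suc x) y = refl

arrangements≡C : ∀ x y → arrangements x y ≡ (x + y) C x
arrangements≡C zero    y       = refl
arrangements≡C (suc x) zero    = sym (trans (cong (_C suc x) (+-identityʳ (suc x))) (nCn≡1 (suc x)))
arrangements≡C (suc x) (suc y) = begin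
  arrangements x (suc y) + arrangements (suc x) y   ≡⟨ cong₂ _+_ (arrangements≡C x (suc y)) (arrangements≡C (suc x) y) ⟩
  (x + suc y) C x + suc (x + y) C suc x             ≡⟨ cong (λ n → n C x + suc (x + y) C suc x) (+-suc x y) ⟩
  suc (x + y) C x + suc (x + y) C suc x             ≡⟨ nCk+nC[k+1]≡[n+1]C[k+1] (suc (x + y)) x ⟩
  suc (suc (x + y)) C suc x                         ≡⟨ cong (λ n → suc n C suc x) (+-suc x y) ⟨
  (suc x + suc y) C suc x                           ∎

mutual
  numWords-arrangements : ∀ m k r a → k + r + a ≡ m →
    numWords m k r ≡ arrangements r a * arrangements r k
  numWords-arrangements zero    zero    zero    zero    refl = refl
  numWords-arrangements zero    (suc k) r       a       ()
  numWords-arrangements zero    zero    (suc r) a       ()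
  numWords-arrangements zero    zero    zero    (suc a) ()
  numWords-arrangements (suc m) k       r       zero    eq   = begin
    numWords (suc m) k r
      ≡⟨ numWords-suc m k r ⟩
    numWordsNotStartingWithR (suc m) k r + numWords m k r
      ≡⟨ cong₂ _+_ (numWordsNotStartingWithR-arrangements (suc m) k r 0 eq) (numWords≡0 m k r m<k+r) ⟩
    arrangementsNotStartingWithR r 0 * arrangements r k + 0
      ≡⟨ +-identityʳ _ ⟩
    arrangementsNotStartingWithR r 0 * arrangements r k
      ≡⟨ cong (_* arrangements r k) (arrangementsNotStartingWithR-zeroʳ r) ⟩
    arrangements r 0 * arrangements r k ∎
    where
    m<k+r : m < k + r
    m<k+r = ≤-reflexive (trans (sym eq) (+-identityʳ (k + r)))
  numWords-arrangements (suc m) k       r       (suc a) eq   = begin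
    numWords (suc m) k r
      ≡⟨ numWords-suc m k r ⟩
    numWordsNotStartingWithR (suc m) k r + numWords m k r
      ≡⟨ cong₂ _+_ (numWordsNotStartingWithR-arrangements (suc m) k r (suc a) eq)
                   (numWords-arrangements m k r a (suc-injective (trans (sym (+-suc (k + r) a)) eq))) ⟩
    arrangementsNotStartingWithR r (suc a) * arrangements r k + arrangements r a * arrangements r k
      ≡⟨ *-distribʳ-+ (arrangements r k) (arrangementsNotStartingWithR r (suc a)) (arrangements r a) ⟨
    (arrangementsNotStartingWithR r (suc a) + arrangements r a) * arrangements r k
      ≡⟨ cong (_* arrangements r k) (arrangementsNotStartingWithR-suc r a) ⟩
    arrangements r (suc a) * arrangements r k ∎

  numWordsNotStartingWithR-arrangements : ∀ m k r a → k + r + a ≡ m →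
    numWordsNotStartingWithR m k r ≡ arrangementsNotStartingWithR r a * arrangements r k
  numWordsNotStartingWithR-arrangements zero    zero    zero    zero    refl = refl
  numWordsNotStartingWithR-arrangements zero    (suc k) r       a       ()
  numWordsNotStartingWithR-arrangements zero    zero    (suc r) a       ()
  numWordsNotStartingWithR-arrangements zero    zero    zero    (suc a) ()
  numWordsNotStartingWithR-arrangements (suc m) zero    zero    zero    ()
  numWordsNotStartingWithR-arrangements (suc m) zero    zero    (suc a) eq =
    trans (numWordsNotStartingWithR-suc m 0 0)
          (cong₂ _+_ (numWordsStartingWithLu-zero m 0) (numWordsStartingWithLm-zero m 0))
  numWordsNotStartingWithR-arrangements (suc m) (suc k) zero    a       eq =
    trans (numWordsNotStartingWithR-suc m (suc k) 0)
          (cong₂ _+_ (numWordsStartingWithLu-zero m (suc k))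
                     (numWordsNotStartingWithR-arrangements m k 0 a (suc-injective eq)))
  numWordsNotStartingWithR-arrangements (suc m) zero    (suc r) a       eq = begin
    numWordsNotStartingWithR (suc m) 0 (suc r)
      ≡⟨ numWordsNotStartingWithR-suc m 0 (suc r) ⟩
    numWordsStartingWith Lu m 0 (suc r) + numWordsStartingWith Lm m 0 (suc r)
      ≡⟨ cong₂ _+_ (trans (numWordsStartingWithLu-suc m 0 r) (numWords-arrangements m 0 r a (suc-injective eq)))
                   (numWordsStartingWithLm-zero m (suc r)) ⟩
    arrangements r a * arrangements r 0 + 0
      ≡⟨ +-identityʳ _ ⟩
    arrangements r a * arrangements r 0
      ≡⟨ cong (arrangements r a *_) (arrangements-zeroʳ r) ⟩
    arrangements r a * 1 ∎
  numWordsNotStartingWithR-arrangements (suc m) (suc k) (suc r) a       eq = begin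
    numWordsNotStartingWithR (suc m) (suc k) (suc r)
      ≡⟨ numWordsNotStartingWithR-suc m (suc k) (suc r) ⟩
    numWordsStartingWith Lu m (suc k) (suc r) + numWordsStartingWith Lm m (suc k) (suc r)
      ≡⟨ cong₂ _+_ (trans (numWordsStartingWithLu-suc m (suc k) r) (numWords-arrangements m (suc k) r a eqLu))
                   (numWordsNotStartingWithR-arrangements m k (suc r) a (suc-injective eq)) ⟩
    arrangements r a * arrangements r (suc k) + arrangements r a * arrangements (suc r) k
      ≡⟨ *-distribˡ-+ (arrangements r a) (arrangements r (suc k)) (arrangements (suc r) k) ⟨
    arrangements r a * arrangements (suc r) (suc k) ∎
    where
    eqLu : suc k + r + a ≡ m
    eqLu = trans (cong (_+ a) (sym (+-suc k r))) (suc-injective eq)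

proposition5p7 : (n k r : ℕ) → 1 ≤ n → k + r ≤ n ∸ 1 →
    numWords (n ∸ 1) k r ≡ ((n ∸ k ∸ 1) C r) * ((r + k) C r)
proposition5p7 (suc m) k r _ k+r≤m = begin
  numWords m k r                          ≡⟨ numWords-arrangements m k r a k+r+a≡m ⟩
  arrangements r a * arrangements r k     ≡⟨ cong₂ _*_ (arrangements≡C r a) (arrangements≡C r k) ⟩
  ((r + a) C r) * ((r + k) C r)          ≡⟨ cong (λ n → (n C r) * ((r + k) C r)) r+a≡n∸k∸1 ⟩
  ((suc m ∸ k ∸ 1) C r) * ((r + k) C r)  ∎
  where
  a : ℕ
  a = m ∸ (k + r)

  k+r+a≡m : k + r + a ≡ m
  k+r+a≡m = m+[n∸m]≡n k+r≤m

  r+a≡n∸k∸1 : r + a ≡ suc m ∸ k ∸ 1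
  r+a≡n∸k∸1 = begin
    r + a               ≡⟨ m+n∸m≡n k (r + a) ⟨
    k + (r + a) ∸ k     ≡⟨ cong (_∸ k) (trans (sym (+-assoc k r a)) k+r+a≡m) ⟩
    m ∸ k               ≡⟨ cong (suc m ∸_) (+-comm 1 k) ⟩
    suc m ∸ (k + 1)     ≡⟨ ∸-+-assoc (suc m) k 1 ⟨
    suc m ∸ k ∸ 1       ∎
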